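{- For every term $r$ and types $A,B$ such that $r\in[\![A\wedge B]\!]$, we have $\pi_A(r)\in[\![A]\!]$.
   Context: Polymorphic System I. Types: $A ::= X \mid A\Rightarrow A \mid A\wedge A \mid \forall X.A$ ($FTV$ free type variables, modulo $\alpha$). Type isomorphism $\equiv$: smallest congruence containing $A\wedge B\equiv B\wedge A$; $A\wedge(B\wedge C)\equiv(A\wedge B)\wedge C$; $A\Rightarrow(B\wedge C)\equiv(A\Rightarrow B)\wedge(A\Rightarrow C)$; $(A\wedge B)\Rightarrow C\equiv A\Rightarrow B\Rightarrow C$; $\forall X.(A\Rightarrow B)\equiv A\Rightarrow\forall X.B$ if $X\notin FTV(A)$; $\forall X.(A\wedge B)\equiv\forall X.A\wedge\forall X.B$. Terms: $r ::= x^A \mid \lambda x^A.r \mid rr \mid \langle r,r\rangle \mid \pi_A(r) \mid \Lambda X.r \mid r[A]$, typed by: $\Gamma,x:A\vdash x:A$; from $\Gamma\vdash r:A$, $A\equiv B$ infer $\Gamma\vdash r:B$; from $\Gamma,x:A\vdash r:B$ infer $\Gamma\vdash\lambda x^A.r:A\Rightarrow B$; from $\Gamma\vdash r:A\Rightarrow B$, $\Gamma\vdash s:A$ infer $\Gamma\vdash rs:B$; from $\Gamma\vdash r:A$, $\Gamma\vdash s:B$ infer $\Gamma\vdash\langle r,s\rangle:A\wedge B$; from $\Gamma\vdash r:A\wedge B$ infer $\Gamma\vdash\pi_A(r):A$; from $\Gamma\vdash r:A$, $X\notin FTV(\Gamma)$ infer $\Gamma\vdash\Lambda X.r:\forall X.A$;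 from $\Gamma\vdash r:\forall X.A$ infer $\Gamma\vdash r[B]:[X:=B]A$. Term equivalence $\rightleftarrows$: symmetric, closed under term constructors, generated by $\langle r,s\rangle\rightleftarrows\langle s,r\rangle$; $\langle r,\langle s,t\rangle\rangle\rightleftarrows\langle\langle r,s\rangle,t\rangle$; $\lambda x^A.\langle r,s\rangle\rightleftarrows\langle\lambda x^A.r,\lambda x^A.s\rangle$; $\langle r,s\rangle t\rightleftarrows\langle rt,st\rangle$; $r\langle s,t\rangle\rightleftarrows (rs)t$; $\Lambda X.\lambda x^A.r\rightleftarrows\lambda x^A.\Lambda X.r$ if $X\notin FTV(A)$; $(\lambda x^A.r)[B]\rightleftarrows\lambda x^A.(r[B])$; $\Lambda X.\langle r,s\rangle\rightleftarrows\langle\Lambda X.r,\Lambda X.s\rangle$; $\langle r,s\rangle[A]\rightleftarrows\langle r[A],s[A]\rangle$; $\pi_{\forall X.A}(\Lambda X.r)\rightleftarrows\Lambda X.\pi_A(r)$; $(\pi_{\forall X.B}(r))[A]\rightleftarrows\pi_{[X:=A]B}(r[A])$ if $r$ has type $\forall X.(B\wedge C)$. Reduction $\hookrightarrow$: closure under term constructors of $(\lambda x^A.r)s\hookrightarrow[x:=s]r$ if $s$ has type $A$; $(\Lambda X.r)[A]\hookrightarrow[X:=A]r$; $\pi_A(\langle r,s\rangle)\hookrightarrow r$ if $r$ has type $A$. $\to\ :=\ \rightleftarrows^*\circ\hookrightarrow\circ\rightleftarrows^*$; $\mathsf{SN}$ is the set of typed terms strongly normalising for $\to$. Elimination contexts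 (hole $[\cdot]_A$ of type $A$): $[\cdot]_A$ has type $A$; if $K$ has type $B\Rightarrow C$ and $s\in\mathsf{SN}$ has type $B$, then $Ks$ has type $C$; if $K$ has type $B\wedge C$ then $\pi_B(K)$ has type $B$; if $K$ has type $\forall X.B$ then $K[C]$ has type $[X:=C]B$. $K[t]$ is $K$ with its hole replaced by $t$. $\mathcal T(K)$: $\mathcal T([\cdot]_A)=\emptyset$, $\mathcal T(Ks)=\mathcal T(K)\uplus\{s\}$, $\mathcal T(\pi_B(K))=\mathcal T(K[C])=\mathcal T(K)$. $[\![A]\!]$ is the set of terms $r$ of type $A$ such that for every elimination context $K$ with hole of type $A$, whose type is a type variable, with all terms of $\mathcal T(K)$ in $\mathsf{SN}$, we have $K[r]\in\mathsf{SN}$. -}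

module Defs where

open import Data.Nat using (ℕ; zero; suc)
open import Data.List using (List; []; _∷_; map; _++_)
open import Data.List.Relation.Unary.All using (All)
open import Data.Product using (Σ; ∃; _×_; _,_)
open import Relation.Binary.PropositionalEquality using (_≡_)
open import Relation.Binary.Construct.Closure.ReflexiveTransitive using (Star)
open import Induction.WellFounded using (Acc)

-- Types of polymorphic System I.  Type variables are de Bruijn indices,
-- so types are identified modulo α-conversion definitionally.

infixr 7 _⇒_
infixr 8 _∧_

data Ty : Set where
  tv  : ℕ → Ty
  _⇒_ : Ty → Ty → Ty
  _∧_ : Ty → Ty → Ty
  Π   : Ty → Ty         -- ∀X.A  (binds index 0)

shiftVar : ℕ → ℕ → ℕ
shiftVar zero    n       = suc n
shiftVar (suc c) zero    = zero
shiftVar (suc c) (suc n) = suc (shiftVar c n)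

shiftTy : ℕ → Ty → Ty
shiftTy c (tv n)  = tv (shiftVar c n)
shiftTy c (A ⇒ B) = shiftTy c A ⇒ shiftTy c B
shiftTy c (A ∧ B) = shiftTy c A ∧ shiftTy c B
shiftTy c (Π A)   = Π (shiftTy (suc c) A)

-- substitution [c := B] on a variable (decrementing variables above c)
substVar : ℕ → ℕ → Ty → Ty
substVar zero    zero    B = B
substVar zero    (suc n) B = tv n
substVar (suc c) zero    B = tv zero
substVar (suc c) (suc n) B = shiftTy zero (substVar c n B)

substTy : ℕ → Ty → Ty → Ty
substTy c B (tv n)    = substVar c n B
substTy c B (A₁ ⇒ A₂) = substTy c B A₁ ⇒ substTy c B A₂
substTy c B (A₁ ∧ A₂) = substTy c B A₁ ∧ substTy c B A₂
substTy c B (Π A)     = Π (substTy (suc c) B A)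

_[_]ᵗ : Ty → Ty → Ty
A [ B ]ᵗ = substTy zero B A

-- Type isomorphism ≡ (smallest congruence containing the axioms).
-- The side condition X ∉ FTV(A) is rendered by writing the weakening
-- (shiftTy 0 A) of a type A living outside the binder.

infix 4 _≅_
data _≅_ : Ty → Ty → Set where
  comm    : ∀ {A B}   → A ∧ B ≅ B ∧ A
  assoc   : ∀ {A B C} → A ∧ (B ∧ C) ≅ (A ∧ B) ∧ C
  distr   : ∀ {A B C} → A ⇒ (B ∧ C) ≅ (A ⇒ B) ∧ (A ⇒ C)
  curry   : ∀ {A B C} → (A ∧ B) ⇒ C ≅ A ⇒ B ⇒ C
  ∀⇒      : ∀ {A B}   → Π (shiftTy zero A ⇒ B) ≅ A ⇒ Π B
  ∀∧      : ∀ {A B}   → Π (A ∧ B) ≅ Π A ∧ Π B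
  refl≅   : ∀ {A} → A ≅ A
  sym≅    : ∀ {A B} → A ≅ B → B ≅ A
  trans≅  : ∀ {A B C} → A ≅ B → B ≅ C → A ≅ C
  cong⇒   : ∀ {A A' B B'} → A ≅ A' → B ≅ B' → A ⇒ B ≅ A' ⇒ B'
  cong∧   : ∀ {A A' B B'} → A ≅ A' → B ≅ B' → A ∧ B ≅ A' ∧ B'
  congΠ   : ∀ {A A'} → A ≅ A' → Π A ≅ Π A'

-- Terms (Church style; term variables are de Bruijn indices into a
-- typing context, type annotations are types).

data Tm : Set where
  var  : ℕ → Tm
  lam  : Ty → Tm → Tm
  app  : Tm → Tm → Tm
  pair : Tm → Tm → Tm
  proj : Ty → Tm → Tm
  tlam : Tm → Tm
  tapp : Tm → Ty → Tm

Ctx : Set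
Ctx = List Ty

shiftTm : ℕ → Tm → Tm
shiftTm c (var n)    = var (shiftVar c n)
shiftTm c (lam A r)  = lam A (shiftTm (suc c) r)
shiftTm c (app r s)  = app (shiftTm c r) (shiftTm c s)
shiftTm c (pair r s) = pair (shiftTm c r) (shiftTm c s)
shiftTm c (proj A r) = proj A (shiftTm c r)
shiftTm c (tlam r)   = tlam (shiftTm c r)
shiftTm c (tapp r A) = tapp (shiftTm c r) A

tshiftTm : ℕ → Tm → Tm
tshiftTm c (var n)    = var n
tshiftTm c (lam A r)  = lam (shiftTy c A) (tshiftTm c r)
tshiftTm c (app r s)  = app (tshiftTm c r) (tshiftTm c s)
tshiftTm c (pair r s) = pair (tshiftTm c r) (tshiftTm c s)
tshiftTm c (proj A r) = proj (shiftTy c A) (tshiftTm c r)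
tshiftTm c (tlam r)   = tlam (tshiftTm (suc c) r)
tshiftTm c (tapp r A) = tapp (tshiftTm c r) (shiftTy c A)

tsubstTm : ℕ → Ty → Tm → Tm
tsubstTm c B (var n)    = var n
tsubstTm c B (lam A r)  = lam (substTy c B A) (tsubstTm c B r)
tsubstTm c B (app r s)  = app (tsubstTm c B r) (tsubstTm c B s)
tsubstTm c B (pair r s) = pair (tsubstTm c B r) (tsubstTm c B s)
tsubstTm c B (proj A r) = proj (substTy c B A) (tsubstTm c B r)
tsubstTm c B (tlam r)   = tlam (tsubstTm (suc c) B r)
tsubstTm c B (tapp r A) = tapp (tsubstTm c B r) (substTy c B A)

substTmVar : ℕ → ℕ → Tm → Tm
substTmVar zero    zero    s = s
substTmVar zero    (suc n) s = var n
substTmVar (suc c) zero    s = var zero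
substTmVar (suc c) (suc n) s = shiftTm zero (substTmVar c n s)

substTm : ℕ → Tm → Tm → Tm
substTm c s (var n)    = substTmVar c n s
substTm c s (lam A r)  = lam A (substTm (suc c) s r)
substTm c s (app r t)  = app (substTm c s r) (substTm c s t)
substTm c s (pair r t) = pair (substTm c s r) (substTm c s t)
substTm c s (proj A r) = proj A (substTm c s r)
substTm c s (tlam r)   = tlam (substTm c (tshiftTm zero s) r)
substTm c s (tapp r A) = tapp (substTm c s r) A

infix 4 _∋_∶_ _⊢_∶_
data _∋_∶_ : Ctx → ℕ → Ty → Set where
  here  : ∀ {Γ A} → (A ∷ Γ) ∋ zero ∶ A
  there : ∀ {Γ A B n} → Γ ∋ n ∶ A → (B ∷ Γ) ∋ suc n ∶ A

-- ΛX with X ∉ FTV(Γ): the body is typed in the weakened context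
data _⊢_∶_ : Ctx → Tm → Ty → Set where
  ax    : ∀ {Γ n A} → Γ ∋ n ∶ A → Γ ⊢ var n ∶ A
  conv  : ∀ {Γ r A B} → Γ ⊢ r ∶ A → A ≅ B → Γ ⊢ r ∶ B
  ⇒i    : ∀ {Γ r A B} → (A ∷ Γ) ⊢ r ∶ B → Γ ⊢ lam A r ∶ A ⇒ B
  ⇒e    : ∀ {Γ r s A B} → Γ ⊢ r ∶ A ⇒ B → Γ ⊢ s ∶ A → Γ ⊢ app r s ∶ B
  ∧i    : ∀ {Γ r s A B} → Γ ⊢ r ∶ A → Γ ⊢ s ∶ B → Γ ⊢ pair r s ∶ A ∧ B
  ∧e    : ∀ {Γ r A B} → Γ ⊢ r ∶ A ∧ B → Γ ⊢ proj A r ∶ A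
  ∀i    : ∀ {Γ r A} → map (shiftTy zero) Γ ⊢ r ∶ A → Γ ⊢ tlam r ∶ Π A
  ∀e    : ∀ {Γ r A B} → Γ ⊢ r ∶ Π A → Γ ⊢ tapp r B ∶ A [ B ]ᵗ

infix 4 _⊢_⇄_ _⊢_↪_ _⊢_⟶_
data _⊢_⇄_ : Ctx → Tm → Tm → Set where
  comm    : ∀ {Γ r s} → Γ ⊢ pair r s ⇄ pair s r
  assoc   : ∀ {Γ r s t} → Γ ⊢ pair r (pair s t) ⇄ pair (pair r s) t
  distλ   : ∀ {Γ A r s} → Γ ⊢ lam A (pair r s) ⇄ pair (lam A r) (lam A s)
  distapp : ∀ {Γ r s t} → Γ ⊢ app (pair r s) t ⇄ pair (app r t) (app s t)
  curry   : ∀ {Γ r s t} → Γ ⊢ app r (pair s t) ⇄ app (app r s) t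
  Λλ      : ∀ {Γ A r} → Γ ⊢ tlam (lam (shiftTy zero A) r) ⇄ lam A (tlam r)
  λ[]     : ∀ {Γ A B r} → Γ ⊢ tapp (lam A r) B ⇄ lam A (tapp r B)
  Λpair   : ∀ {Γ r s} → Γ ⊢ tlam (pair r s) ⇄ pair (tlam r) (tlam s)
  pair[]  : ∀ {Γ A r s} → Γ ⊢ tapp (pair r s) A ⇄ pair (tapp r A) (tapp s A)
  πΛ      : ∀ {Γ A r} → Γ ⊢ proj (Π A) (tlam r) ⇄ tlam (proj A r)
  π[]     : ∀ {Γ A B C r} → Γ ⊢ r ∶ Π (B ∧ C) →
            Γ ⊢ tapp (proj (Π B) r) A ⇄ proj (B [ A ]ᵗ) (tapp r A)
  sym     : ∀ {Γ r s} → Γ ⊢ r ⇄ s → Γ ⊢ s ⇄ r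
  c-lam   : ∀ {Γ A r r'} → (A ∷ Γ) ⊢ r ⇄ r' → Γ ⊢ lam A r ⇄ lam A r'
  c-appˡ  : ∀ {Γ r r' s} → Γ ⊢ r ⇄ r' → Γ ⊢ app r s ⇄ app r' s
  c-appʳ  : ∀ {Γ r s s'} → Γ ⊢ s ⇄ s' → Γ ⊢ app r s ⇄ app r s'
  c-pairˡ : ∀ {Γ r r' s} → Γ ⊢ r ⇄ r' → Γ ⊢ pair r s ⇄ pair r' s
  c-pairʳ : ∀ {Γ r s s'} → Γ ⊢ s ⇄ s' → Γ ⊢ pair r s ⇄ pair r s'
  c-proj  : ∀ {Γ A r r'} → Γ ⊢ r ⇄ r' → Γ ⊢ proj A r ⇄ proj A r'
  c-tlam  : ∀ {Γ r r'} → map (shiftTy zero) Γ ⊢ r ⇄ r' → Γ ⊢ tlam r ⇄ tlam r'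
  c-tapp  : ∀ {Γ A r r'} → Γ ⊢ r ⇄ r' → Γ ⊢ tapp r A ⇄ tapp r' A

data _⊢_↪_ : Ctx → Tm → Tm → Set where
  β       : ∀ {Γ A r s} → Γ ⊢ s ∶ A → Γ ⊢ app (lam A r) s ↪ substTm zero s r
  βΛ      : ∀ {Γ A r} → Γ ⊢ tapp (tlam r) A ↪ tsubstTm zero A r
  βπ      : ∀ {Γ A r s} → Γ ⊢ r ∶ A → Γ ⊢ proj A (pair r s) ↪ r
  c-lam   : ∀ {Γ A r r'} → (A ∷ Γ) ⊢ r ↪ r' → Γ ⊢ lam A r ↪ lam A r'
  c-appˡ  : ∀ {Γ r r' s} → Γ ⊢ r ↪ r' → Γ ⊢ app r s ↪ app r' s
  c-appʳ  : ∀ {Γ r s s'} → Γ ⊢ s ↪ s' → Γ ⊢ app r s ↪ app r s'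
  c-pairˡ : ∀ {Γ r r' s} → Γ ⊢ r ↪ r' → Γ ⊢ pair r s ↪ pair r' s
  c-pairʳ : ∀ {Γ r s s'} → Γ ⊢ s ↪ s' → Γ ⊢ pair r s ↪ pair r s'
  c-proj  : ∀ {Γ A r r'} → Γ ⊢ r ↪ r' → Γ ⊢ proj A r ↪ proj A r'
  c-tlam  : ∀ {Γ r r'} → map (shiftTy zero) Γ ⊢ r ↪ r' → Γ ⊢ tlam r ↪ tlam r'
  c-tapp  : ∀ {Γ A r r'} → Γ ⊢ r ↪ r' → Γ ⊢ tapp r A ↪ tapp r' A

_⊢_⇄*_ : Ctx → Tm → Tm → Set
Γ ⊢ r ⇄* s = Star (_⊢_⇄_ Γ) r s

data _⊢_⟶_ (Γ : Ctx) (r s : Tm) : Set where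
  step : ∀ {r' s'} → Γ ⊢ r ⇄* r' → Γ ⊢ r' ↪ s' → Γ ⊢ s' ⇄* s → Γ ⊢ r ⟶ s

SN : Ctx → Tm → Set
SN Γ r = (∃ λ A → Γ ⊢ r ∶ A) × Acc (λ s t → Γ ⊢ t ⟶ s) r

data Elim : Set where
  hole  : Ty → Elim
  eapp  : Elim → Tm → Elim
  eproj : Ty → Elim → Elim
  etapp : Elim → Ty → Elim

holeTy : Elim → Ty
holeTy (hole A)    = A
holeTy (eapp K s)  = holeTy K
holeTy (eproj B K) = holeTy K
holeTy (etapp K C) = holeTy K

infix 4 _⊢ₑ_∶_
data _⊢ₑ_∶_ (Γ : Ctx) : Elim → Ty → Set where
  hole  : ∀ {A} → Γ ⊢ₑ hole A ∶ A
  eapp  : ∀ {K s B C} → Γ ⊢ₑ K ∶ B ⇒ C → SN Γ s → Γ ⊢ s ∶ B → Γ ⊢ₑ eapp K s ∶ C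
  eproj : ∀ {K B C} → Γ ⊢ₑ K ∶ B ∧ C → Γ ⊢ₑ eproj B K ∶ B
  etapp : ∀ {K B C} → Γ ⊢ₑ K ∶ Π B → Γ ⊢ₑ etapp K C ∶ B [ C ]ᵗ

plug : Elim → Tm → Tm
plug (hole A)    t = t
plug (eapp K s)  t = app (plug K t) s
plug (eproj B K) t = proj B (plug K t)
plug (etapp K C) t = tapp (plug K t) C

-- 𝒯(K) (multiset, as a list)
𝒯 : Elim → List Tm
𝒯 (hole A)    = []
𝒯 (eapp K s)  = 𝒯 K ++ (s ∷ [])
𝒯 (eproj B K) = 𝒯 K
𝒯 (etapp K C) = 𝒯 K

⟦_⟧ : Ty → Ctx → Tm → Set
⟦ A ⟧ Γ r = Γ ⊢ r ∶ A ×
  (∀ (K : Elim) (X : ℕ) → holeTy K ≡ A → Γ ⊢ₑ K ∶ tv X →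
     All (SN Γ) (𝒯 K) → SN Γ (plug K r))

module Submission where

open import Defs hiding (sym)
open import Data.List using (_++_)
open import Data.List.Properties using (++-assoc; ++-identityʳ)
open import Data.List.Relation.Unary.All using (All)
open import Data.Product using (_,_)
open import Relation.Binary.PropositionalEquality using (_≡_; refl; cong; subst; sym; trans)

-- π_A(r) ∈ ⟦A⟧ because every test K[π_A(r)] is a test (K ∘ π_A([·])) applied to r.

infixl 5 _∘ₑ_

_∘ₑ_ : Elim → Elim → Elim
hole _    ∘ₑ L = L
eapp K s  ∘ₑ L = eapp (K ∘ₑ L) s
eproj C K ∘ₑ L = eproj C (K ∘ₑ L)
etapp K C ∘ₑ L = etapp (K ∘ₑ L) C

holeTy-∘ₑ : ∀ K L → holeTy (K ∘ₑ L) ≡ holeTy L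
holeTy-∘ₑ (hole _)    L = refl
holeTy-∘ₑ (eapp K s)  L = holeTy-∘ₑ K L
holeTy-∘ₑ (eproj C K) L = holeTy-∘ₑ K L
holeTy-∘ₑ (etapp K C) L = holeTy-∘ₑ K L

plug-∘ₑ : ∀ K L t → plug (K ∘ₑ L) t ≡ plug K (plug L t)
plug-∘ₑ (hole _)    L t = refl
plug-∘ₑ (eapp K s)  L t = cong (λ u → app u s) (plug-∘ₑ K L t)
plug-∘ₑ (eproj C K) L t = cong (proj C) (plug-∘ₑ K L t)
plug-∘ₑ (etapp K C) L t = cong (λ u → tapp u C) (plug-∘ₑ K L t)

𝒯-∘ₑ : ∀ K L → 𝒯 (K ∘ₑ L) ≡ 𝒯 L ++ 𝒯 K
𝒯-∘ₑ (hole _)    L = sym (++-identityʳ (𝒯 L))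
𝒯-∘ₑ (eapp K s)  L = trans (cong (_++ _) (𝒯-∘ₑ K L)) (++-assoc (𝒯 L) (𝒯 K) _)
𝒯-∘ₑ (eproj C K) L = 𝒯-∘ₑ K L
𝒯-∘ₑ (etapp K C) L = 𝒯-∘ₑ K L

∘ₑ-typed : ∀ {Γ K L T} → Γ ⊢ₑ L ∶ holeTy K → Γ ⊢ₑ K ∶ T → Γ ⊢ₑ K ∘ₑ L ∶ T
∘ₑ-typed ⊢L hole               = ⊢L
∘ₑ-typed ⊢L (eapp ⊢K sn-s ⊢s) = eapp (∘ₑ-typed ⊢L ⊢K) sn-s ⊢s
∘ₑ-typed ⊢L (eproj ⊢K)         = eproj (∘ₑ-typed ⊢L ⊢K)
∘ₑ-typed ⊢L (etapp ⊢K)         = etapp (∘ₑ-typed ⊢L ⊢K)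

mainTheorem17 : ∀ (Γ : Ctx) (r : Tm) (A B : Ty) → ⟦ A ∧ B ⟧ Γ r → ⟦ A ⟧ Γ (proj A r)
mainTheorem17 Γ r A B (⊢r , r-red) = ∧e ⊢r , proj-red
  where
  πA : Elim
  πA = eproj A (hole (A ∧ B))

  proj-red : ∀ K X → holeTy K ≡ A → Γ ⊢ₑ K ∶ tv X → All (SN Γ) (𝒯 K) →
             SN Γ (plug K (proj A r))
  proj-red K X refl ⊢K sn-𝒯K =
    subst (SN Γ) (plug-∘ₑ K πA r)
      (r-red (K ∘ₑ πA) X (holeTy-∘ₑ K πA) (∘ₑ-typed (eproj hole) ⊢K)
             (subst (All (SN Γ)) (sym (𝒯-∘ₑ K πA)) sn-𝒯K))
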